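{- Let $n\ge 1$ and let $L_S$ be the $(4n+1)\times(4n+1)$ symmetric tridiagonal matrix whose off-diagonal entries $(L_S)_{j,j+1}=(L_S)_{j+1,j}$ are all $-1$ and whose diagonal entries are $d_1=d_{4n+1}=3$ and, for $2\le j\le 4n$, $d_j=4$ if $j\equiv 0$ or $1 \pmod 4$ and $d_j=2$ if $j\equiv 2$ or $3\pmod 4$. For $k=1,\dots,4n$ let $c_k$ be the determinant of the $k\times k$ principal submatrix of $L_S$ formed by its first $k$ rows and columns. Put $A=15+4\sqrt{14}$ and $B=15-4\sqrt{14}$. Then for $0\le i\le n-1$, \[ c_{4i+1}=\frac{(10+3\sqrt{14})A^{i}-(10-3\sqrt{14})B^{i}}{2\sqrt{14}},\qquad c_{4i+2}=\frac{(18+5\sqrt{14})A^{i}-(18-5\sqrt{14})B^{i}}{2\sqrt{14}}, \] \[ c_{4i+3}=\frac{(26+7\sqrt{14})A^{i}-(26-7\sqrt{14})B^{i}}{2\sqrt{14}},\qquad c_{4i+4}=\frac{(86+23\sqrt{14})A^{i}-(86-23\sqrt{14})B^{i}}{2\sqrt{14}}. \]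
   Context: The matrix $L_S$ arises as follows: for the linear octagonal-quadrilateral network $L_n$ (vertices $1,\dots,4n+1$ and $1',\dots,(4n+1)'$, edges $\{j,j+1\}$ and $\{j',(j+1)'\}$ for $1\le j\le 4n$, and edges $\{j,j'\}$ for $j=1$ and for $j\equiv 0,1\pmod 4$ with $4\le j\le 4n+1$), writing the Laplacian in blocks indexed by $V_1=\{1,\dots,4n+1\}$, $V_2=\{1',\dots,(4n+1)'\}$, one has $L_S=L_{V_1V_1}-L_{V_1V_2}$. -}

module Defs where

open import Data.Nat as ℕ using (ℕ; zero; suc; _%_)
open import Data.Nat.Properties using () renaming (_≟_ to _≟ℕ_)
open import Data.Integer as ℤ using (ℤ; +_; -_; -[1+_])
open import Data.Fin using (Fin; toℕ; punchIn) renaming (zero to fzero; suc to fsuc)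
open import Data.Bool using (Bool; true; false; if_then_else_; _∨_)
open import Relation.Nullary.Decidable using (⌊_⌋)

Matrix : ℕ → Set
Matrix k = Fin k → Fin k → ℤ

sumFin : (k : ℕ) → (Fin k → ℤ) → ℤ
sumFin zero    f = + 0
sumFin (suc k) f = f fzero ℤ.+ sumFin k (λ j → f (fsuc j))

sign : ℕ → ℤ
sign zero          = + 1
sign (suc zero)    = -[1+ 0 ]
sign (suc (suc m)) = sign m

minor : {k : ℕ} → Matrix (suc k) → Fin (suc k) → Matrix k
minor M j r c = M (fsuc r) (punchIn j c)

det : (k : ℕ) → Matrix k → ℤ
det zero    M = + 1
det (suc k) M = sumFin (suc k) (λ j → sign (toℕ j) ℤ.* (M fzero j ℤ.* det k (minor M j)))

-- The matrix L_S of size (4n+1), with 1-based indices a, b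

diagEntry : ℕ → ℕ → ℤ
diagEntry n a =
  if ⌊ a ≟ℕ 1 ⌋ ∨ ⌊ a ≟ℕ (4 ℕ.* n ℕ.+ 1) ⌋ then + 3
  else if ⌊ a % 4 ≟ℕ 0 ⌋ ∨ ⌊ a % 4 ≟ℕ 1 ⌋ then + 4
  else + 2

LS-entry : ℕ → ℕ → ℕ → ℤ
LS-entry n a b =
  if ⌊ a ≟ℕ b ⌋ then diagEntry n a
  else if ⌊ suc a ≟ℕ b ⌋ ∨ ⌊ a ≟ℕ suc b ⌋ then -[1+ 0 ]
  else + 0

-- leading principal k×k submatrix of L_S (meaningful for k ≤ 4n+1)
LS-principal : (n k : ℕ) → Matrix k
LS-principal n k i j = LS-entry n (suc (toℕ i)) (suc (toℕ j))

c : (n k : ℕ) → ℤ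
c n k = det k (LS-principal n k)

record ℤ√14 : Set where
  constructor _+_√14
  field
    re : ℤ
    im : ℤ
open ℤ√14 public

_⊕_ : ℤ√14 → ℤ√14 → ℤ√14
(a + b √14) ⊕ (c' + d √14) = (a ℤ.+ c') + (b ℤ.+ d) √14

_⊖_ : ℤ√14 → ℤ√14 → ℤ√14
(a + b √14) ⊖ (c' + d √14) = (a ℤ.- c') + (b ℤ.- d) √14

_⊗_ : ℤ√14 → ℤ√14 → ℤ√14
(a + b √14) ⊗ (c' + d √14) =
  (a ℤ.* c' ℤ.+ + 14 ℤ.* (b ℤ.* d)) + (a ℤ.* d ℤ.+ b ℤ.* c') √14

_^√_ : ℤ√14 → ℕ → ℤ√14
x ^√ zero  = (+ 1) + (+ 0) √14
x ^√ suc m = x ⊗ (x ^√ m)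

embed : ℤ → ℤ√14
embed z = z + (+ 0) √14

A B twoRoot14 : ℤ√14
A = (+ 15) + (+ 4) √14
B = (+ 15) + (- (+ 4)) √14
twoRoot14 = (+ 0) + (+ 2) √14

numer : ℤ → ℤ → ℕ → ℤ√14
numer p q i = ((p + q √14) ⊗ (A ^√ i)) ⊖ ((p + (- q) √14) ⊗ (B ^√ i))

-- Expanding along the first row, the leading principal minors of a tridiagonal matrix whose
-- off-diagonal entries are all −1 form the continuant of its diagonal: c_{k+2} = d_{k+2} c_{k+1} − c_k.
-- After its first entry the diagonal of L_S repeats 2, 2, 4, 4, so four steps of this recurrence send
-- (c_{4i+1}, c_{4i+2}) to (26 c_{4i+2} − 15 c_{4i+1}, 45 c_{4i+2} − 26 c_{4i+1}), a map with eigenvalues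
-- A and B. In ℤ[√14] the same combinations of the coefficients 10 + 3√14 and 18 + 5√14 are
-- (10 + 3√14) A and (18 + 5√14) A, and conjugation handles the B-parts, so the closed forms propagate by
-- induction on i; c_{4i+3} = 2 c_{4i+2} − c_{4i+1} and c_{4i+4} = 7 c_{4i+2} − 4 c_{4i+1} follow.

module Submission where

open import Data.Bool using (true; false; if_then_else_; _∨_)
open import Data.Fin using (Fin; toℕ) renaming (zero to fzero; suc to fsuc)
open import Data.Integer using (ℤ; +_; -_; -[1+_]; _-_)
open import Data.Nat as ℕ using (ℕ; zero; suc; z≤n; s≤s; _%_)
import Data.Nat.Properties as ℕP
open import Data.Nat.DivMod using (%-remove-+ˡ)
open import Data.Nat.Divisibility using (∣-refl)
open import Data.Product using (_×_; _,_; proj₁; proj₂)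
open import Relation.Binary.PropositionalEquality
open import Relation.Nullary.Decidable using (⌊_⌋; dec-no)

open import Defs

module _ where
  open ≡-Reasoning
  open import Data.Integer using (_+_; _*_)
  open import Data.Integer.Properties using (+-identityʳ; *-identityˡ; *-zeroʳ; *-comm)
  open import Data.Integer.Tactic.RingSolver using (solve-∀)

  sumFin-zero : ∀ k (f : Fin k → ℤ) → (∀ j → f j ≡ + 0) → sumFin k f ≡ + 0
  sumFin-zero zero    f f≡0 = refl
  sumFin-zero (suc k) f f≡0 =
    cong₂ _+_ (f≡0 fzero) (sumFin-zero k (λ j → f (fsuc j)) (λ j → f≡0 (fsuc j)))

  expansionTerm : ∀ {k} → Matrix (suc k) → Fin (suc k) → ℤ
  expansionTerm {k} M j = sign (toℕ j) * (M fzero j * det k (minor M j))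

  expansionTerm-zeroEntry : ∀ {k} (M : Matrix (suc k)) j → M fzero j ≡ + 0 → expansionTerm M j ≡ + 0
  expansionTerm-zeroEntry {k} M j eq =
    trans (cong (λ x → sign (toℕ j) * (x * det k (minor M j))) eq) (*-zeroʳ (sign (toℕ j)))

  expansionTerm-zeroMinor : ∀ {k} (M : Matrix (suc k)) j → det k (minor M j) ≡ + 0 → expansionTerm M j ≡ + 0
  expansionTerm-zeroMinor {k} M j eq = begin
    sign (toℕ j) * (M fzero j * det k (minor M j)) ≡⟨ cong (λ x → sign (toℕ j) * (M fzero j * x)) eq ⟩
    sign (toℕ j) * (M fzero j * + 0)               ≡⟨ cong (sign (toℕ j) *_) (*-zeroʳ (M fzero j)) ⟩
    sign (toℕ j) * + 0                             ≡⟨ *-zeroʳ (sign (toℕ j)) ⟩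
    + 0                                            ∎

  mutual
    det-zeroColumn : ∀ k (M : Matrix (suc k)) → (∀ r → M r fzero ≡ + 0) → det (suc k) M ≡ + 0
    det-zeroColumn k M column≡0 =
      cong₂ _+_ (expansionTerm-zeroEntry M fzero (column≡0 fzero))
                (expansionTail-zero k M (λ r → column≡0 (fsuc r)))

    expansionTail-zero : ∀ k (M : Matrix (suc k)) → (∀ r → M (fsuc r) fzero ≡ + 0) →
      sumFin k (λ j → expansionTerm M (fsuc j)) ≡ + 0
    expansionTail-zero zero    M below≡0 = refl
    expansionTail-zero (suc k) M below≡0 = sumFin-zero (suc k) _ λ j →
      expansionTerm-zeroMinor M (fsuc j) (det-zeroColumn k (minor M (fsuc j)) below≡0)

  det-firstColumn : ∀ k (M : Matrix (suc k)) → (∀ r → M (fsuc r) fzero ≡ + 0) →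
    det (suc k) M ≡ M fzero fzero * det k (minor M fzero)
  det-firstColumn k M below≡0 = begin
    expansionTerm M fzero + sumFin k (λ j → expansionTerm M (fsuc j))
      ≡⟨ cong (λ s → expansionTerm M fzero + s) (expansionTail-zero k M below≡0) ⟩
    expansionTerm M fzero + + 0
      ≡⟨ +-identityʳ _ ⟩
    + 1 * (M fzero fzero * det k (minor M fzero))
      ≡⟨ *-identityˡ _ ⟩
    M fzero fzero * det k (minor M fzero) ∎

  det-firstRowTwoEntries : ∀ k (M : Matrix (suc (suc k))) → (∀ j → M fzero (fsuc (fsuc j)) ≡ + 0) →
    det (suc (suc k)) M ≡
      M fzero fzero * det (suc k) (minor M fzero) - M fzero (fsuc fzero) * det (suc k) (minor M (fsuc fzero))
  det-firstRowTwoEntries k M row≡0 = begin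
    expansionTerm M fzero + (expansionTerm M (fsuc fzero) + sumFin k (λ j → expansionTerm M (fsuc (fsuc j))))
      ≡⟨ cong (λ s → expansionTerm M fzero + (expansionTerm M (fsuc fzero) + s))
              (sumFin-zero k _ (λ j → expansionTerm-zeroEntry M (fsuc (fsuc j)) (row≡0 j))) ⟩
    + 1 * x + (-[1+ 0 ] * y + + 0)
      ≡⟨ signs x y ⟩
    x - y ∎
    where
    x = M fzero fzero * det (suc k) (minor M fzero)
    y = M fzero (fsuc fzero) * det (suc k) (minor M (fsuc fzero))
    signs : ∀ x y → + 1 * x + (-[1+ 0 ] * y + + 0) ≡ x - y
    signs = solve-∀

  leading : (ℕ → ℕ → ℤ) → (k : ℕ) → Matrix k
  leading F k i j = F (toℕ i) (toℕ j)

  shift : (ℕ → ℕ → ℤ) → ℕ → ℕ → ℤ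
  shift F a b = F (suc a) (suc b)

  record IsTridiagonal (F : ℕ → ℕ → ℤ) : Set where
    field
      superdiagonal : ∀ a → F a (suc a) ≡ -[1+ 0 ]
      subdiagonal   : ∀ a → F (suc a) a ≡ -[1+ 0 ]
      above-band    : ∀ {a b} → suc a ℕ.< b → F a b ≡ + 0
      below-band    : ∀ {a b} → suc b ℕ.< a → F a b ≡ + 0

  shift-tridiagonal : ∀ {F} → IsTridiagonal F → IsTridiagonal (shift F)
  shift-tridiagonal t = record
    { superdiagonal = λ a → superdiagonal (suc a)
    ; subdiagonal   = λ a → subdiagonal (suc a)
    ; above-band    = λ lt → above-band (s≤s lt)
    ; below-band    = λ lt → below-band (s≤s lt)
    }
    where open IsTridiagonal t

  det-leading-recurrence : ∀ {F} → IsTridiagonal F → ∀ k →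
    det (suc (suc k)) (leading F (suc (suc k))) ≡
      F 0 0 * det (suc k) (leading (shift F) (suc k)) - det k (leading (shift (shift F)) k)
  det-leading-recurrence {F} t k = begin
    det (suc (suc k)) L
      ≡⟨ det-firstRowTwoEntries k L (λ _ → above-band (s≤s (s≤s z≤n))) ⟩
    F 0 0 * D₁ - F 0 1 * det (suc k) (minor L (fsuc fzero))
      ≡⟨ cong (λ x → F 0 0 * D₁ - F 0 1 * x)
              (det-firstColumn k (minor L (fsuc fzero)) (λ _ → below-band (s≤s (s≤s z≤n)))) ⟩
    F 0 0 * D₁ - F 0 1 * (F 1 0 * D₂)
      ≡⟨ cong₂ (λ x y → F 0 0 * D₁ - x * (y * D₂)) (superdiagonal 0) (subdiagonal 0) ⟩
    F 0 0 * D₁ - -[1+ 0 ] * (-[1+ 0 ] * D₂)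
      ≡⟨ signs (F 0 0) D₁ D₂ ⟩
    F 0 0 * D₁ - D₂ ∎
    where
    open IsTridiagonal t
    L  = leading F (suc (suc k))
    D₁ = det (suc k) (leading (shift F) (suc k))
    D₂ = det k (leading (shift (shift F)) k)
    signs : ∀ x y z → x * y - -[1+ 0 ] * (-[1+ 0 ] * z) ≡ x * y - z
    signs = solve-∀

  continuant : (ℕ → ℤ) → ℕ → ℤ
  continuant d zero          = + 1
  continuant d (suc zero)    = d 0
  continuant d (suc (suc k)) = d (suc k) * continuant d (suc k) - continuant d k

  continuant-unfoldˡ : ∀ d k → continuant d (suc (suc k)) ≡
    d 0 * continuant (λ a → d (suc a)) (suc k) - continuant (λ a → d (suc (suc a))) k
  continuant-unfoldˡ d zero = cong (_- + 1) (*-comm (d 1) (d 0))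
  continuant-unfoldˡ d (suc zero) = two (d 0) (d 1) (d 2)
    where
    two : ∀ x y z → z * (y * x - + 1) - x ≡ x * (z * y - + 1) - z
    two = solve-∀
  continuant-unfoldˡ d (suc (suc k)) =
    trans (cong₂ (λ x y → d (3 ℕ.+ k) * x - y) (continuant-unfoldˡ d (suc k)) (continuant-unfoldˡ d k))
          (interchange (d 0) (d (3 ℕ.+ k)) (K′ (2 ℕ.+ k)) (K″ (suc k)) (K′ (suc k)) (K″ k))
    where
    K′ = continuant (λ a → d (suc a))
    K″ = continuant (λ a → d (suc (suc a)))
    interchange : ∀ x w a b c e → w * (x * a - b) - (x * c - e) ≡ x * (w * a - c) - (w * b - e)
    interchange = solve-∀

  continuant-cong : ∀ k {d d′ : ℕ → ℤ} → (∀ a → a ℕ.< k → d a ≡ d′ a) →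
    continuant d k ≡ continuant d′ k
  continuant-cong zero          d≡d′ = refl
  continuant-cong (suc zero)    d≡d′ = d≡d′ 0 (s≤s z≤n)
  continuant-cong (suc (suc k)) d≡d′ =
    cong₂ _-_ (cong₂ _*_ (d≡d′ (suc k) (ℕP.n<1+n (suc k)))
                         (continuant-cong (suc k) (λ a lt → d≡d′ a (ℕP.m<n⇒m<1+n lt))))
              (continuant-cong k (λ a lt → d≡d′ a (ℕP.m<n⇒m<1+n (ℕP.m<n⇒m<1+n lt))))

  continuant-suc² : ∀ d k {δ x y} →
    d (suc k) ≡ δ → continuant d (suc k) ≡ x → continuant d k ≡ y →
    continuant d (suc (suc k)) ≡ δ * x - y
  continuant-suc² d k refl refl refl = refl

  det-leading≡continuant : ∀ {F} → IsTridiagonal F → ∀ k →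
    det k (leading F k) ≡ continuant (λ a → F a a) k
  det-leading≡continuant t zero = refl
  det-leading≡continuant {F} t (suc zero) = unit (F 0 0)
    where
    unit : ∀ x → + 1 * (x * + 1) + + 0 ≡ x
    unit = solve-∀
  det-leading≡continuant {F} t (suc (suc k)) = begin
    det (suc (suc k)) (leading F (suc (suc k)))
      ≡⟨ det-leading-recurrence t k ⟩
    F 0 0 * det (suc k) (leading (shift F) (suc k)) - det k (leading (shift (shift F)) k)
      ≡⟨ cong₂ (λ x y → F 0 0 * x - y) (det-leading≡continuant (shift-tridiagonal t) (suc k))
                                        (det-leading≡continuant (shift-tridiagonal (shift-tridiagonal t)) k) ⟩
    F 0 0 * continuant (λ a → F (suc a) (suc a)) (suc k)
      - continuant (λ a → F (suc (suc a)) (suc (suc a))) k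
      ≡⟨ continuant-unfoldˡ (λ a → F a a) k ⟨
    continuant (λ a → F a a) (suc (suc k)) ∎

  _·_ : ℤ → ℤ√14 → ℤ√14
  u · (x + y √14) = (u * x) + (u * y) √14

  conj : ℤ√14 → ℤ√14
  conj (x + y √14) = x + (- y) √14

  ⊗-assoc : ∀ x y z → (x ⊗ y) ⊗ z ≡ x ⊗ (y ⊗ z)
  ⊗-assoc (a + b √14) (c + d √14) (e + f √14) =
    cong₂ _+_√14 (rational a b c d e f) (irrational a b c d e f)
    where
    rational : ∀ a b c d e f → (a * c + + 14 * (b * d)) * e + + 14 * ((a * d + b * c) * f)
                         ≡ a * (c * e + + 14 * (d * f)) + + 14 * (b * (c * f + d * e))
    rational = solve-∀
    irrational : ∀ a b c d e f → (a * c + + 14 * (b * d)) * f + (a * d + b * c) * e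
                               ≡ a * (c * f + d * e) + b * (c * e + + 14 * (d * f))
    irrational = solve-∀

  conj-⊗ : ∀ x y → conj x ⊗ conj y ≡ conj (x ⊗ y)
  conj-⊗ (a + b √14) (c + d √14) = cong₂ _+_√14 (rational a b c d) (irrational a b c d)
    where
    rational : ∀ a b c d → a * c + + 14 * (- b * - d) ≡ a * c + + 14 * (b * d)
    rational = solve-∀
    irrational : ∀ a b c d → a * - d + - b * c ≡ - (a * d + b * c)
    irrational = solve-∀

  embed-⊗-linear : ∀ u v a b t →
    embed (u * b - v * a) ⊗ t ≡ (u · (embed b ⊗ t)) ⊖ (v · (embed a ⊗ t))
  embed-⊗-linear u v a b (t + s √14) =
    cong₂ _+_√14 (rational u v a b t s) (irrational u v a b t s)
    where
    rational : ∀ u v a b t s → (u * b - v * a) * t + + 14 * (+ 0 * s)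
                         ≡ u * (b * t + + 14 * (+ 0 * s)) - v * (a * t + + 14 * (+ 0 * s))
    rational = solve-∀
    irrational : ∀ u v a b t s → (u * b - v * a) * s + + 0 * t
                               ≡ u * (b * s + + 0 * t) - v * (a * s + + 0 * t)
    irrational = solve-∀

  -- numer p q i = binet (p + q √14) (A ^√ i) (B ^√ i), since B = conj A
  binet : ℤ√14 → ℤ√14 → ℤ√14 → ℤ√14
  binet α X Y = (α ⊗ X) ⊖ (conj α ⊗ Y)

  binet-⊗ : ∀ α β X Y → binet α (β ⊗ X) (conj β ⊗ Y) ≡ binet (α ⊗ β) X Y
  binet-⊗ α β X Y = begin
    (α ⊗ (β ⊗ X)) ⊖ (conj α ⊗ (conj β ⊗ Y))
      ≡⟨ cong₂ _⊖_ (⊗-assoc α β X) (⊗-assoc (conj α) (conj β) Y) ⟨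
    ((α ⊗ β) ⊗ X) ⊖ ((conj α ⊗ conj β) ⊗ Y)
      ≡⟨ cong (λ γ → ((α ⊗ β) ⊗ X) ⊖ (γ ⊗ Y)) (conj-⊗ α β) ⟩
    ((α ⊗ β) ⊗ X) ⊖ (conj (α ⊗ β) ⊗ Y) ∎

  binet-linear : ∀ u v α β X Y →
    (u · binet β X Y) ⊖ (v · binet α X Y) ≡ binet ((u · β) ⊖ (v · α)) X Y
  binet-linear u v (p + q √14) (p′ + q′ √14) (x + x′ √14) (y + y′ √14) =
    cong₂ _+_√14 (rational u v p q p′ q′ x x′ y y′) (irrational u v p q p′ q′ x x′ y y′)
    where
    rational : ∀ u v p q p′ q′ x x′ y y′ →
        u * ((p′ * x + + 14 * (q′ * x′)) - (p′ * y + + 14 * (- q′ * y′)))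
      - v * ((p * x + + 14 * (q * x′)) - (p * y + + 14 * (- q * y′)))
      ≡ ((u * p′ - v * p) * x + + 14 * ((u * q′ - v * q) * x′))
      - ((u * p′ - v * p) * y + + 14 * (- (u * q′ - v * q) * y′))
    rational = solve-∀
    irrational : ∀ u v p q p′ q′ x x′ y y′ →
        u * ((p′ * x′ + q′ * x) - (p′ * y′ + - q′ * y))
      - v * ((p * x′ + q * x) - (p * y′ + - q * y))
      ≡ ((u * p′ - v * p) * x′ + (u * q′ - v * q) * x)
      - ((u * p′ - v * p) * y′ + - (u * q′ - v * q) * y)
    irrational = solve-∀

  ⌊≟⌋-refl : ∀ a → ⌊ a ℕP.≟ a ⌋ ≡ true
  ⌊≟⌋-refl a = cong ⌊_⌋ (ℕP.≟-diag refl)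

  ⌊≟⌋-≢ : ∀ {a b} → a ≢ b → ⌊ a ℕP.≟ b ⌋ ≡ false
  ⌊≟⌋-≢ {a} {b} a≢b = cong ⌊_⌋ (dec-no (a ℕP.≟ b) a≢b)

  ⌊≟⌋-< : ∀ {a b} → a ℕ.< b → ⌊ a ℕP.≟ b ⌋ ≡ false
  ⌊≟⌋-< a<b = ⌊≟⌋-≢ (ℕP.<⇒≢ a<b)

  ⌊≟⌋-> : ∀ {a b} → b ℕ.< a → ⌊ a ℕP.≟ b ⌋ ≡ false
  ⌊≟⌋-> b<a = ⌊≟⌋-≢ (ℕP.>⇒≢ b<a)

  LS-entry-via : ∀ n {a b x y z} →
    ⌊ a ℕP.≟ b ⌋ ≡ x → ⌊ suc a ℕP.≟ b ⌋ ≡ y → ⌊ a ℕP.≟ suc b ⌋ ≡ z →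
    LS-entry n a b ≡ (if x then diagEntry n a else if y ∨ z then -[1+ 0 ] else + 0)
  LS-entry-via n refl refl refl = refl

  LS-entry-diagonal : ∀ n a → LS-entry n a a ≡ diagEntry n a
  LS-entry-diagonal n a = LS-entry-via n (⌊≟⌋-refl a) refl refl

  LS-tridiagonal : ∀ n → IsTridiagonal (LS-entry n)
  LS-tridiagonal n = record
    { superdiagonal = λ a →
        LS-entry-via n (⌊≟⌋-< (ℕP.n<1+n a)) (⌊≟⌋-refl (suc a)) (⌊≟⌋-< (s≤s (ℕP.n≤1+n a)))
    ; subdiagonal   = λ a →
        LS-entry-via n (⌊≟⌋-> (ℕP.n<1+n a)) (⌊≟⌋-> (s≤s (ℕP.n≤1+n a))) (⌊≟⌋-refl (suc a))
    ; above-band    = λ lt →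
        LS-entry-via n (⌊≟⌋-< (ℕP.<⇒≤ lt)) (⌊≟⌋-< lt) (⌊≟⌋-< (ℕP.m<n⇒m<1+n (ℕP.<⇒≤ lt)))
    ; below-band    = λ lt →
        LS-entry-via n (⌊≟⌋-> (ℕP.<⇒≤ lt)) (⌊≟⌋-> (ℕP.m<n⇒m<1+n (ℕP.<⇒≤ lt))) (⌊≟⌋-> lt)
    }

  residueEntry : ℕ → ℤ
  residueEntry r = if ⌊ r ℕP.≟ 0 ⌋ ∨ ⌊ r ℕP.≟ 1 ⌋ then + 4 else + 2

  diagEntry-via : ∀ n {b x y} → ⌊ b ℕP.≟ 1 ⌋ ≡ x → ⌊ b ℕP.≟ 4 ℕ.* n ℕ.+ 1 ⌋ ≡ y →
    diagEntry n b ≡ (if x ∨ y then + 3 else residueEntry (b % 4))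
  diagEntry-via n refl refl = refl

  -- periodicDiagonal a = d_{a+2}
  periodicDiagonal : ℕ → ℤ
  periodicDiagonal 0 = + 2
  periodicDiagonal 1 = + 2
  periodicDiagonal 2 = + 4
  periodicDiagonal 3 = + 4
  periodicDiagonal (suc (suc (suc (suc a)))) = periodicDiagonal a

  periodicDiagonal-period : ∀ i a → periodicDiagonal (a ℕ.+ i ℕ.* 4) ≡ periodicDiagonal a
  periodicDiagonal-period i a = trans (cong periodicDiagonal (ℕP.+-comm a (i ℕ.* 4))) (shifted i)
    where
    shifted : ∀ i → periodicDiagonal (i ℕ.* 4 ℕ.+ a) ≡ periodicDiagonal a
    shifted zero    = refl
    shifted (suc i) = shifted i

  residueEntry-periodic : ∀ a → residueEntry (suc (suc a) % 4) ≡ periodicDiagonal a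
  residueEntry-periodic 0 = refl
  residueEntry-periodic 1 = refl
  residueEntry-periodic 2 = refl
  residueEntry-periodic 3 = refl
  residueEntry-periodic (suc (suc (suc (suc a)))) =
    trans (cong residueEntry (%-remove-+ˡ (suc (suc a)) {4} ∣-refl)) (residueEntry-periodic a)

  -- LS-diagonal a = d_{a+1}; it disagrees with L_S only at the last entry d_{4n+1} = 3
  LS-diagonal : ℕ → ℤ
  LS-diagonal zero    = + 3
  LS-diagonal (suc a) = periodicDiagonal a

  diagEntry-interior : ∀ n a → a ℕ.< 4 ℕ.* n → diagEntry n (suc a) ≡ LS-diagonal a
  diagEntry-interior n zero    a<4n = refl
  diagEntry-interior n (suc a) a<4n =
    trans (diagEntry-via n (⌊≟⌋-> {suc (suc a)} (s≤s (s≤s z≤n))) (⌊≟⌋-< below-last))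
          (residueEntry-periodic a)
    where
    below-last : suc (suc a) ℕ.< 4 ℕ.* n ℕ.+ 1
    below-last = ℕP.≤-trans (s≤s a<4n) (ℕP.≤-reflexive (ℕP.+-comm 1 (4 ℕ.* n)))

  c≡continuant : ∀ n k → k ℕ.≤ 4 ℕ.* n → c n k ≡ continuant LS-diagonal k
  c≡continuant n k k≤4n = begin
    det k (leading (shift (LS-entry n)) k)
      ≡⟨ det-leading≡continuant (shift-tridiagonal (LS-tridiagonal n)) k ⟩
    continuant (λ a → LS-entry n (suc a) (suc a)) k
      ≡⟨ continuant-cong k (λ a a<k → trans (LS-entry-diagonal n (suc a))
                                            (diagEntry-interior n a (ℕP.<-≤-trans a<k k≤4n))) ⟩
    continuant LS-diagonal k ∎

  module PeriodBlock (d : ℕ → ℤ) (k : ℕ) (d₂ : d (2 ℕ.+ k) ≡ + 2) (d₃ : d (3 ℕ.+ k) ≡ + 4)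
                     (d₄ : d (4 ℕ.+ k) ≡ + 4) (d₅ : d (5 ℕ.+ k) ≡ + 2) where
    a b : ℤ
    a = continuant d (1 ℕ.+ k)
    b = continuant d (2 ℕ.+ k)

    third : continuant d (3 ℕ.+ k) ≡ + 2 * b - + 1 * a
    third = trans (continuant-suc² d (suc k) d₂ refl refl) (step a b)
      where
      step : ∀ a b → + 2 * b - a ≡ + 2 * b - + 1 * a
      step = solve-∀

    fourth : continuant d (4 ℕ.+ k) ≡ + 7 * b - + 4 * a
    fourth = trans (continuant-suc² d (2 ℕ.+ k) d₃ third refl) (step a b)
      where
      step : ∀ a b → + 4 * (+ 2 * b - + 1 * a) - b ≡ + 7 * b - + 4 * a
      step = solve-∀

    fifth : continuant d (5 ℕ.+ k) ≡ + 26 * b - + 15 * a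
    fifth = trans (continuant-suc² d (3 ℕ.+ k) d₄ fourth third) (step a b)
      where
      step : ∀ a b → + 4 * (+ 7 * b - + 4 * a) - (+ 2 * b - + 1 * a) ≡ + 26 * b - + 15 * a
      step = solve-∀

    sixth : continuant d (6 ℕ.+ k) ≡ + 45 * b - + 26 * a
    sixth = trans (continuant-suc² d (4 ℕ.+ k) d₅ fifth fourth) (step a b)
      where
      step : ∀ a b → + 2 * (+ 26 * b - + 15 * a) - (+ 7 * b - + 4 * a) ≡ + 45 * b - + 26 * a
      step = solve-∀

  module LS-periodBlock (i : ℕ) = PeriodBlock LS-diagonal (i ℕ.* 4)
    (periodicDiagonal-period i 1) (periodicDiagonal-period i 2)
    (periodicDiagonal-period i 3) (periodicDiagonal-period i 0)

  record HasClosedForm (z : ℤ) (α : ℤ√14) (i : ℕ) : Set where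
    constructor closedForm
    field equation : embed z ⊗ twoRoot14 ≡ binet α (A ^√ i) (B ^√ i)
  open HasClosedForm

  HasClosedForm-≡ : ∀ {z z′ α i} → z ≡ z′ → HasClosedForm z′ α i → HasClosedForm z α i
  HasClosedForm-≡ refl h = h

  closedForm-combination : ∀ {a b α β i} u v → HasClosedForm a α i → HasClosedForm b β i →
    HasClosedForm (u * b - v * a) ((u · β) ⊖ (v · α)) i
  closedForm-combination {a} {b} {α} {β} {i} u v ha hb = closedForm (begin
    embed (u * b - v * a) ⊗ twoRoot14
      ≡⟨ embed-⊗-linear u v a b twoRoot14 ⟩
    (u · (embed b ⊗ twoRoot14)) ⊖ (v · (embed a ⊗ twoRoot14))
      ≡⟨ cong₂ (λ y z → (u · y) ⊖ (v · z)) (equation hb) (equation ha) ⟩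
    (u · binet β (A ^√ i) (B ^√ i)) ⊖ (v · binet α (A ^√ i) (B ^√ i))
      ≡⟨ binet-linear u v α β (A ^√ i) (B ^√ i) ⟩
    binet ((u · β) ⊖ (v · α)) (A ^√ i) (B ^√ i) ∎)

  closedForm-suc : ∀ {z α i} → HasClosedForm z (α ⊗ A) i → HasClosedForm z α (suc i)
  closedForm-suc {α = α} {i} h =
    closedForm (trans (equation h) (sym (binet-⊗ α A (A ^√ i) (B ^√ i))))

  -- the coefficient updates below hold by evaluation: e.g. 26 (18 + 5√14) − 15 (10 + 3√14) = (10 + 3√14) A
  closedForm₁₂ : ∀ i → HasClosedForm (continuant LS-diagonal (1 ℕ.+ i ℕ.* 4)) ((+ 10) + (+ 3) √14) i
                     × HasClosedForm (continuant LS-diagonal (2 ℕ.+ i ℕ.* 4)) ((+ 18) + (+ 5) √14) i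
  closedForm₁₂ zero    = closedForm refl , closedForm refl
  closedForm₁₂ (suc i) =
      closedForm-suc (HasClosedForm-≡ fifth (closedForm-combination (+ 26) (+ 15) h₁ h₂))
    , closedForm-suc (HasClosedForm-≡ sixth (closedForm-combination (+ 45) (+ 26) h₁ h₂))
    where
    open LS-periodBlock i
    h₁ = proj₁ (closedForm₁₂ i)
    h₂ = proj₂ (closedForm₁₂ i)

  closedForm₃₄ : ∀ i → HasClosedForm (continuant LS-diagonal (3 ℕ.+ i ℕ.* 4)) ((+ 26) + (+ 7) √14) i
                     × HasClosedForm (continuant LS-diagonal (4 ℕ.+ i ℕ.* 4)) ((+ 86) + (+ 23) √14) i
  closedForm₃₄ i =
      HasClosedForm-≡ third (closedForm-combination (+ 2) (+ 1) h₁ h₂)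
    , HasClosedForm-≡ fourth (closedForm-combination (+ 7) (+ 4) h₁ h₂)
    where
    open LS-periodBlock i
    h₁ = proj₁ (closedForm₁₂ i)
    h₂ = proj₂ (closedForm₁₂ i)

open import Data.Nat using (ℕ; _+_; _*_; _<_; _≤_)
open HasClosedForm using (equation)

lemma3p1 : (n : ℕ) → 1 ≤ n → (i : ℕ) → i < n →
    (embed (c n (4 * i + 1)) ⊗ twoRoot14 ≡ numer (+ 10) (+ 3) i)
    × (embed (c n (4 * i + 2)) ⊗ twoRoot14 ≡ numer (+ 18) (+ 5) i)
    × (embed (c n (4 * i + 3)) ⊗ twoRoot14 ≡ numer (+ 26) (+ 7) i)
    × (embed (c n (4 * i + 4)) ⊗ twoRoot14 ≡ numer (+ 86) (+ 23) i)
lemma3p1 n _ i i<n =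
    trans (c-in-block 1 (s≤s z≤n)) (equation (proj₁ (closedForm₁₂ i)))
  , trans (c-in-block 2 (s≤s (s≤s z≤n))) (equation (proj₂ (closedForm₁₂ i)))
  , trans (c-in-block 3 (s≤s (s≤s (s≤s z≤n)))) (equation (proj₁ (closedForm₃₄ i)))
  , trans (c-in-block 4 ℕP.≤-refl) (equation (proj₂ (closedForm₃₄ i)))
  where
  c-in-block : ∀ j → j ≤ 4 →
    embed (c n (4 * i + j)) ⊗ twoRoot14 ≡ embed (continuant LS-diagonal (j + i * 4)) ⊗ twoRoot14
  c-in-block j j≤4 = cong (λ z → embed z ⊗ twoRoot14)
    (trans (c≡continuant n (4 * i + j) bound) (cong (continuant LS-diagonal) index))
    where
    index : 4 * i + j ≡ j + i * 4
    index = trans (ℕP.+-comm (4 * i) j) (cong (λ m → j + m) (ℕP.*-comm 4 i))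
    open ℕP.≤-Reasoning
    bound : 4 * i + j ≤ 4 * n
    bound = begin
      4 * i + j ≤⟨ ℕP.+-monoʳ-≤ (4 * i) j≤4 ⟩
      4 * i + 4 ≡⟨ ℕP.+-comm (4 * i) 4 ⟩
      4 + 4 * i ≡⟨ ℕP.*-suc 4 i ⟨
      4 * suc i ≤⟨ ℕP.*-monoʳ-≤ 4 i<n ⟩
      4 * n     ∎
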